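{- Every rooted directed path graph belongs to $\textsc{And}(1)$.
   Context: All graphs are finite, simple and connected. A graph $G=(V,E)$ is a rooted directed path graph if there exist a rooted tree $T$, with every arc oriented from the root towards the leaves, and for each $v\in V$ a directed path $K_v$ in $T$, such that for distinct $u,v$: $uv\in E$ iff $K_u$ and $K_v$ share a vertex of $T$. An $\textsc{And}(1)$-realization of $G$ is a family $\{([L(v),R(v)],p_v):v\in V\}$ of closed real intervals and points $p_v\in[L(v),R(v)]$ such that for distinct $u,v$: $uv\in E$ iff $p_v\in[L(u),R(u)]$ and $p_u\in[L(v),R(v)]$. $\textsc{And}(1)$ is the class of graphs admitting an $\textsc{And}(1)$-realization. -}

module Defs where

open import Data.Nat using (ℕ; _<_)
open import Data.Fin using (Fin)
open import Data.Maybe using (Maybe; just; nothing)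
open import Data.List using (List; []; _∷_)
open import Data.List.Membership.Propositional using (_∈_)
open import Data.Product using (Σ; ∃; ∃-syntax; _×_; _,_)
open import Data.Rational using (ℚ) renaming (_≤_ to _≤ℚ_)
open import Relation.Binary.PropositionalEquality using (_≡_; _≢_)
open import Relation.Nullary using (¬_)
open import Function.Bundles using (_⇔_)

data Walk {n : ℕ} (E : Fin n → Fin n → Set) : Fin n → Fin n → Set where
  here : ∀ {u} → Walk E u u
  step : ∀ {u v w} → E u v → Walk E v w → Walk E u w

record Graph : Set₁ where
  field
    n         : ℕ
    E         : Fin n → Fin n → Set
    irrefl    : ∀ v → ¬ E v v
    sym       : ∀ {u v} → E u v → E v u
    connected : ∀ u v → Walk E u v

-- Finite rooted trees on node set Fin m, arcs oriented from root to leaves: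
-- every node has at most one parent; exactly one node (the root) has none;
-- a depth function strictly decreasing towards the parent guarantees acyclicity
-- (hence every node is reached from the root by a unique directed path).

record RootedTree : Set where
  field
    m         : ℕ
    parent    : Fin m → Maybe (Fin m)
    root      : Fin m
    root-top  : parent root ≡ nothing
    root-uniq : ∀ t → parent t ≡ nothing → t ≡ root
    depth     : Fin m → ℕ
    depth-dec : ∀ t s → parent t ≡ just s → depth s < depth t

Arc : (T : RootedTree) → Fin (RootedTree.m T) → Fin (RootedTree.m T) → Set
Arc T s t = RootedTree.parent T t ≡ just s

data IsDPath (T : RootedTree) : List (Fin (RootedTree.m T)) → Set where
  single : ∀ t → IsDPath T (t ∷ [])
  cons   : ∀ s t ts → Arc T s t → IsDPath T (t ∷ ts) → IsDPath T (s ∷ t ∷ ts)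

DPath : RootedTree → Set
DPath T = Σ (List (Fin (RootedTree.m T))) (IsDPath T)

_onPath_ : {T : RootedTree} → Fin (RootedTree.m T) → DPath T → Set
t onPath (ts , _) = t ∈ ts

IsRDPG : Graph → Set
IsRDPG G =
  Σ RootedTree λ T →
  Σ (Fin (Graph.n G) → DPath T) λ K →
    ∀ (u v : Fin (Graph.n G)) → u ≢ v →
      (Graph.E G u v ⇔ (∃[ t ] (_onPath_ {T} t (K u) × _onPath_ {T} t (K v))))

_∈I_ : ℚ → ℚ × ℚ → Set
x ∈I (l , r) = l ≤ℚ x × x ≤ℚ r

IsAnd1Realization : (G : Graph) → (Fin (Graph.n G) → ℚ × ℚ) → (Fin (Graph.n G) → ℚ) → Set
IsAnd1Realization G I p =
  (∀ v → p v ∈I I v) ×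
  (∀ (u v : Fin (Graph.n G)) → u ≢ v →
     (Graph.E G u v ⇔ (p v ∈I I u × p u ∈I I v)))

InAnd1 : Graph → Set
InAnd1 G = ∃[ I ] ∃[ p ] IsAnd1Realization G I p

{-# OPTIONS --safe #-}
module Submission where

open import Defs
open import Data.Nat using (ℕ; zero; suc; _+_; _*_; _∸_; _^_; _≤_; _<_; z≤n; s≤s; s≤s⁻¹; pred; >-nonZero)
open import Data.Nat.Properties hiding (_≟_)
open import Data.Fin using (Fin; toℕ; _≟_)
open import Data.Fin.Properties using (toℕ<n; toℕ-injective)
open import Data.Maybe using (just; nothing)
open import Data.List using (_∷_; allFin)
open import Data.List.Relation.Unary.Any using (here; there)
import Data.List.Relation.Unary.All as All
open import Data.List.Membership.Propositional using (_∈_)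
open import Data.List.Membership.Propositional.Properties using (∈-allFin)
open import Data.List.Extrema.Nat using (argmax; f[xs]≤f[argmax])
open import Data.Product using (∃-syntax; _×_; _,_; proj₁; proj₂)
open import Data.Product.Function.NonDependent.Propositional using (_×-⇔_)
open import Data.Sum using (_⊎_; inj₁; inj₂)
open import Data.Empty using (⊥-elim)
open import Relation.Nullary using (yes; no)
open import Relation.Binary.PropositionalEquality
open import Function.Bundles using (_⇔_; mk⇔; Equivalence)
import Function.Properties.Equivalence as ⇔
open import Data.Rational using (ℚ; mkℚ; *≤*) renaming (_≤_ to _≤ℚ_)
import Data.Integer as ℤ
import Data.Integer.Properties as ℤ
open import Data.Nat.Coprimality using (1-coprimeTo) renaming (sym to coprime-sym)

-- The ancestor order ≼ of a rooted tree embeds into containment of integer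
-- intervals: give every node t a slot [lo t, lo t + width t) such that the
-- slots of the children of t are disjoint sub-slots of the slot of t; then
-- t ≼ s iff lo s lies in the slot of t.  Two directed paths with tops a, a′ and
-- bottoms b, b′ meet iff a ≼ b′ and a′ ≼ b, so taking the slot of the top of K v
-- as interval and lo of its bottom as point gives an And(1)-realization.

fromℕ : ℕ → ℚ
fromℕ a = mkℚ (ℤ.+ a) 0 (coprime-sym (1-coprimeTo a))

fromℕ-mono-≤ : ∀ {a b} → a ≤ b → fromℕ a ≤ℚ fromℕ b
fromℕ-mono-≤ {a} {b} a≤b =
  *≤* (subst₂ ℤ._≤_ (sym (ℤ.*-identityʳ (ℤ.+ a))) (sym (ℤ.*-identityʳ (ℤ.+ b))) (ℤ.+≤+ a≤b))

fromℕ-cancel-≤ : ∀ {a b} → fromℕ a ≤ℚ fromℕ b → a ≤ b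
fromℕ-cancel-≤ {a} {b} (*≤* a≤b) =
  ℤ.drop‿+≤+ (subst₂ ℤ._≤_ (ℤ.*-identityʳ (ℤ.+ a)) (ℤ.*-identityʳ (ℤ.+ b)) a≤b)

fromℕ-∈I⇔ : ∀ {a b x} → 0 < b → (fromℕ x ∈I (fromℕ a , fromℕ (pred b))) ⇔ (a ≤ x × x < b)
fromℕ-∈I⇔ 0<b = mk⇔
  (λ (a≤x , x≤b-1) → fromℕ-cancel-≤ a≤x , m≤pred[n]⇒suc[m]≤n {{>-nonZero 0<b}} (fromℕ-cancel-≤ x≤b-1))
  (λ (a≤x , x<b) → fromℕ-mono-≤ a≤x , fromℕ-mono-≤ (<⇒≤pred x<b))

module Ancestry (T : RootedTree) where
  open RootedTree T

  infix 4 _≼_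

  data _≼_ (t : Fin m) : Fin m → Set where
    ≼-refl  : t ≼ t
    ≼-child : ∀ {p c} → t ≼ p → Arc T p c → t ≼ c

  ≼-trans : ∀ {a b c} → a ≼ b → b ≼ c → a ≼ c
  ≼-trans a≼b ≼-refl = a≼b
  ≼-trans a≼b (≼-child b≼p arc) = ≼-child (≼-trans a≼b b≼p) arc

  ≼⇒≡⊎depth< : ∀ {a b} → a ≼ b → a ≡ b ⊎ depth a < depth b
  ≼⇒≡⊎depth< ≼-refl = inj₁ refl
  ≼⇒≡⊎depth< (≼-child {p} {c} a≼p arc) with ≼⇒≡⊎depth< a≼p
  ... | inj₁ refl = inj₂ (depth-dec c p arc)
  ... | inj₂ lt   = inj₂ (<-trans lt (depth-dec c p arc))

  ≼-antisym : ∀ {a b} → a ≼ b → b ≼ a → a ≡ b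
  ≼-antisym a≼b b≼a with ≼⇒≡⊎depth< a≼b | ≼⇒≡⊎depth< b≼a
  ... | inj₁ a≡b | _         = a≡b
  ... | inj₂ _   | inj₁ b≡a  = sym b≡a
  ... | inj₂ a<b | inj₂ b<a  = ⊥-elim (<-asym a<b b<a)

  ≼-total-below : ∀ {x y z} → x ≼ z → y ≼ z → x ≼ y ⊎ y ≼ x
  ≼-total-below ≼-refl            y≼z               = inj₂ y≼z
  ≼-total-below (≼-child x≼p arc) ≼-refl            = inj₁ (≼-child x≼p arc)
  ≼-total-below (≼-child x≼p arc) (≼-child y≼q arc′) with trans (sym arc) arc′
  ... | refl = ≼-total-below x≼p y≼q

  ≼-parent : ∀ {t p c} → t ≼ c → Arc T p c → t ≢ c → t ≼ p
  ≼-parent ≼-refl             _   t≢c = ⊥-elim (t≢c refl)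
  ≼-parent (≼-child t≼q arc′) arc _   with trans (sym arc′) arc
  ... | refl = t≼q

  child-towards : ∀ {p s} → p ≼ s → p ≢ s → ∃[ c ] (Arc T p c × c ≼ s)
  child-towards ≼-refl p≢s = ⊥-elim (p≢s refl)
  child-towards {p} (≼-child {q} {s} p≼q arc) _ with p ≟ q
  ... | yes refl = s , arc , ≼-refl
  ... | no p≢q with child-towards p≼q p≢q
  ...   | c , arc′ , c≼q = c , arc′ , ≼-child c≼q arc

  root-≼ : ∀ s → root ≼ s
  root-≼ s = below (suc (depth s)) s ≤-refl
    where
    below : ∀ n s → depth s < n → root ≼ s
    below (suc n) s d<n with parent s in arc
    ... | nothing = subst (root ≼_) (sym (root-uniq s arc)) ≼-refl
    ... | just p  = ≼-child (below n p (<-≤-trans (depth-dec s p arc) (s≤s⁻¹ d<n))) arc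

module DirectedPaths (T : RootedTree) where
  open RootedTree T
  open Ancestry T

  top : ∀ {ts} → IsDPath T ts → Fin m
  top (single t)         = t
  top (cons s _ _ _ _)   = s

  bottom : ∀ {ts} → IsDPath T ts → Fin m
  bottom (single t)       = t
  bottom (cons _ _ _ _ P) = bottom P

  top-head : ∀ {t ts} (P : IsDPath T (t ∷ ts)) → top P ≡ t
  top-head (single _)         = refl
  top-head (cons _ _ _ _ _)   = refl

  head-≼-bottom : ∀ {t ts} (P : IsDPath T (t ∷ ts)) → t ≼ bottom P
  head-≼-bottom (single t)         = ≼-refl
  head-≼-bottom (cons s t ts arc P) = ≼-trans (≼-child ≼-refl arc) (head-≼-bottom P)

  top-≼-bottom : ∀ {ts} (P : IsDPath T ts) → top P ≼ bottom P
  top-≼-bottom (single t)          = ≼-refl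
  top-≼-bottom P@(cons _ _ _ _ _)  = head-≼-bottom P

  ∈-path⇒ : ∀ {ts x} (P : IsDPath T ts) → x ∈ ts → top P ≼ x × x ≼ bottom P
  ∈-path⇒ (single t)            (here refl) = ≼-refl , ≼-refl
  ∈-path⇒ P@(cons _ _ _ _ _)    (here refl) = ≼-refl , head-≼-bottom P
  ∈-path⇒ (cons s t ts arc P) (there x∈) with ∈-path⇒ P x∈
  ... | topP≼x , x≼bottom =
    ≼-trans (≼-child ≼-refl arc) (subst (_≼ _) (top-head P) topP≼x) , x≼bottom

  -- A node x between s and the bottom, other than s, lies below the child t
  -- of s on the path, since x and t are comparable and x ≼ t would force x ≼ s.
  ∈-path⇐ : ∀ {ts x} (P : IsDPath T ts) → top P ≼ x → x ≼ bottom P → x ∈ ts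
  ∈-path⇐ (single t) t≼x x≼t = here (sym (≼-antisym t≼x x≼t))
  ∈-path⇐ {x = x} (cons s t ts arc P) s≼x x≼bottom with x ≟ s
  ... | yes x≡s = here x≡s
  ... | no x≢s  = there (∈-path⇐ P (subst (_≼ x) (sym (top-head P)) t≼x) x≼bottom)
    where
    t≼x : t ≼ x
    t≼x with ≼-total-below (head-≼-bottom P) x≼bottom
    ... | inj₁ t≼x = t≼x
    ... | inj₂ x≼t with x ≟ t
    ...   | yes refl = ≼-refl
    ...   | no x≢t   = ⊥-elim (x≢s (≼-antisym (≼-parent x≼t arc x≢t) s≼x))

  ∈-path⇔ : ∀ {ts x} (P : IsDPath T ts) → x ∈ ts ⇔ (top P ≼ x × x ≼ bottom P)
  ∈-path⇔ P = mk⇔ (∈-path⇒ P) (λ (top≼x , x≼bottom) → ∈-path⇐ P top≼x x≼bottom)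

  paths-meet⇔ : ∀ {ts us} (P : IsDPath T ts) (Q : IsDPath T us) →
                (∃[ x ] (x ∈ ts × x ∈ us)) ⇔ (top P ≼ bottom Q × top Q ≼ bottom P)
  paths-meet⇔ P Q = mk⇔ meet⇒ meet⇐
    where
    meet⇒ : ∃[ x ] (_ ∈ _ × _ ∈ _) → top P ≼ bottom Q × top Q ≼ bottom P
    meet⇒ (x , x∈P , x∈Q) with ∈-path⇒ P x∈P | ∈-path⇒ Q x∈Q
    ... | topP≼x , x≼botP | topQ≼x , x≼botQ = ≼-trans topP≼x x≼botQ , ≼-trans topQ≼x x≼botP

    -- The higher of the two tops lies on both paths.
    meet⇐ : top P ≼ bottom Q × top Q ≼ bottom P → ∃[ x ] (_ ∈ _ × _ ∈ _)
    meet⇐ (topP≼botQ , topQ≼botP) with ≼-total-below (top-≼-bottom P) topQ≼botP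
    ... | inj₁ topP≼topQ =
      top Q , ∈-path⇐ P topP≼topQ topQ≼botP , ∈-path⇐ Q ≼-refl (top-≼-bottom Q)
    ... | inj₂ topQ≼topP =
      top P , ∈-path⇐ P ≼-refl (top-≼-bottom P) , ∈-path⇐ Q topQ≼topP topP≼botQ

-- The child c of p occupies the sub-slot of p at offset suc (toℕ c) * unit p;
-- these fit inside p because toℕ c < m and width p = suc m * unit p.
module NestedSlots (T : RootedTree) where
  open RootedTree T
  open Ancestry T

  maxDepth : ℕ
  maxDepth = depth (argmax depth root (allFin m))

  depth≤maxDepth : ∀ t → depth t ≤ maxDepth
  depth≤maxDepth t = All.lookup (f[xs]≤f[argmax] root (allFin m)) (∈-allFin t)

  height : Fin m → ℕ
  height t = maxDepth ∸ depth t

  height-child< : ∀ {p c} → Arc T p c → height c < height p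
  height-child< {p} {c} arc = ∸-monoʳ-< (depth-dec c p arc) (depth≤maxDepth c)

  base : ℕ
  base = suc m

  unit : Fin m → ℕ
  unit t = base ^ height t

  width : Fin m → ℕ
  width t = base ^ suc (height t)

  width>0 : ∀ t → 0 < width t
  width>0 t = m^n>0 base (suc (height t))

  width-child≤unit : ∀ {p c} → Arc T p c → width c ≤ unit p
  width-child≤unit arc = ^-monoʳ-≤ base (height-child< arc)

  lo-upto : ℕ → Fin m → ℕ
  lo-upto zero    t = 0
  lo-upto (suc n) t with parent t
  ... | nothing = 0
  ... | just p  = lo-upto n p + suc (toℕ t) * unit p

  lo-upto-stable : ∀ {n₁ n₂} t → depth t < n₁ → depth t < n₂ → lo-upto n₁ t ≡ lo-upto n₂ t
  lo-upto-stable {suc n₁} {suc n₂} t d<n₁ d<n₂ with parent t in arc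
  ... | nothing = refl
  ... | just p  = cong (_+ suc (toℕ t) * unit p)
    (lo-upto-stable p (<-≤-trans (depth-dec t p arc) (s≤s⁻¹ d<n₁))
                      (<-≤-trans (depth-dec t p arc) (s≤s⁻¹ d<n₂)))

  lo : Fin m → ℕ
  lo t = lo-upto (suc (depth t)) t

  lo-child : ∀ {p c} → Arc T p c → lo c ≡ lo p + suc (toℕ c) * unit p
  lo-child {p} {c} arc with parent c | arc
  ... | just .p | refl = cong (_+ suc (toℕ c) * unit p)
    (lo-upto-stable p (depth-dec c p arc) ≤-refl)

  infix 4 _∈slot_

  _∈slot_ : ℕ → Fin m → Set
  x ∈slot t = lo t ≤ x × x < lo t + width t

  lo∈slot : ∀ t → lo t ∈slot t
  lo∈slot t = ≤-refl , m<m+n (lo t) (width>0 t)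

  lo-parent< : ∀ {p c} → Arc T p c → lo p < lo c
  lo-parent< {p} arc = subst (lo p <_) (sym (lo-child arc))
    (m<m+n (lo p) (<-≤-trans (m^n>0 base (height p)) (m≤m+n (unit p) _)))

  end-child≤ : ∀ {p c} → Arc T p c → lo c + width c ≤ lo p + suc (suc (toℕ c)) * unit p
  end-child≤ {p} {c} arc = begin
    lo c + width c                            ≡⟨ cong (_+ width c) (lo-child arc) ⟩
    lo p + suc (toℕ c) * unit p + width c     ≤⟨ +-monoʳ-≤ (lo p + _) (width-child≤unit arc) ⟩
    lo p + suc (toℕ c) * unit p + unit p      ≡⟨ +-assoc (lo p) _ (unit p) ⟩
    lo p + (suc (toℕ c) * unit p + unit p)    ≡⟨ cong (lo p +_) (+-comm _ (unit p)) ⟩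
    lo p + suc (suc (toℕ c)) * unit p         ∎
    where open ≤-Reasoning

  end-child≤end : ∀ {p c} → Arc T p c → lo c + width c ≤ lo p + width p
  end-child≤end {p} {c} arc =
    ≤-trans (end-child≤ arc) (+-monoʳ-≤ (lo p) (*-monoˡ-≤ (unit p) (s≤s (toℕ<n c))))

  ∈slot-parent : ∀ {p c x} → Arc T p c → x ∈slot c → x ∈slot p
  ∈slot-parent arc (lo≤x , x<end) =
    ≤-trans (<⇒≤ (lo-parent< arc)) lo≤x , <-≤-trans x<end (end-child≤end arc)

  ≼⇒∈slot : ∀ {t s} → t ≼ s → ∀ {x} → x ∈slot s → x ∈slot t
  ≼⇒∈slot ≼-refl            x∈s = x∈s
  ≼⇒∈slot (≼-child t≼p arc) x∈c = ≼⇒∈slot t≼p (∈slot-parent arc x∈c)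

  offset-index≤ : ∀ {a u x} i j → a + suc i * u ≤ x → x < a + suc (suc j) * u → i ≤ j
  offset-index≤ {a} {u} i j lower upper =
    s≤s⁻¹ (s≤s⁻¹ (*-cancelʳ-< u _ _ (+-cancelˡ-< a _ _ (≤-<-trans lower upper))))

  sibling-slots-disjoint : ∀ {p c c′ x} → Arc T p c → Arc T p c′ →
                           x ∈slot c → x ∈slot c′ → c ≡ c′
  sibling-slots-disjoint {p} {c} {c′} arc arc′ (lo≤x , x<end) (lo′≤x , x<end′) =
    toℕ-injective (≤-antisym
      (offset-index≤ {lo p} {unit p} (toℕ c) (toℕ c′) (subst (_≤ _) (lo-child arc) lo≤x) (<-≤-trans x<end′ (end-child≤ arc′)))
      (offset-index≤ {lo p} {unit p} (toℕ c′) (toℕ c) (subst (_≤ _) (lo-child arc′) lo′≤x) (<-≤-trans x<end (end-child≤ arc))))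

  -- Induction along the path from the root to t: inductively p ≼ s, and the
  -- child of p towards s has a slot containing lo s, hence it is t.
  ∈slot⇒≼ : ∀ {t s} → root ≼ t → lo s ∈slot t → t ≼ s
  ∈slot⇒≼ {s = s} ≼-refl _ = root-≼ s
  ∈slot⇒≼ {t} {s} (≼-child {p} root≼p arc) s∈t with p ≟ s
  ... | yes refl = ⊥-elim (<⇒≱ (lo-parent< arc) (proj₁ s∈t))
  ... | no p≢s with child-towards (∈slot⇒≼ root≼p (∈slot-parent arc s∈t)) p≢s
  ...   | c , arc′ , c≼s =
    subst (_≼ s) (sibling-slots-disjoint arc′ arc (≼⇒∈slot c≼s (lo∈slot s)) s∈t) c≼s

  ≼⇔∈slot : ∀ {t s} → t ≼ s ⇔ lo s ∈slot t
  ≼⇔∈slot {t} = mk⇔ (λ t≼s → ≼⇒∈slot t≼s (lo∈slot _)) (∈slot⇒≼ (root-≼ t))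

  slotℚ : Fin m → ℚ × ℚ
  slotℚ t = fromℕ (lo t) , fromℕ (pred (lo t + width t))

  ≼⇔∈slotℚ : ∀ {t s} → t ≼ s ⇔ fromℕ (lo s) ∈I slotℚ t
  ≼⇔∈slotℚ {t} = ⇔.trans ≼⇔∈slot (⇔.sym (fromℕ-∈I⇔ (≤-<-trans z≤n (proj₂ (lo∈slot t)))))

corollary2 : (G : Graph) → IsRDPG G → InAnd1 G
corollary2 G (T , K , E⇔meet) = I , p , p∈I , E⇔p∈I
  where
  open Graph G using (n)
  open RootedTree T using (m)
  open DirectedPaths T
  open NestedSlots T

  a b : Fin n → Fin m
  a v = top (proj₂ (K v))
  b v = bottom (proj₂ (K v))

  I : Fin n → ℚ × ℚ
  I v = slotℚ (a v)

  p : Fin n → ℚ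
  p v = fromℕ (lo (b v))

  p∈I : ∀ v → p v ∈I I v
  p∈I v = Equivalence.to ≼⇔∈slotℚ (top-≼-bottom (proj₂ (K v)))

  E⇔p∈I : ∀ u v → u ≢ v → Graph.E G u v ⇔ (p v ∈I I u × p u ∈I I v)
  E⇔p∈I u v u≢v = ⇔.trans (E⇔meet u v u≢v)
    (⇔.trans (paths-meet⇔ (proj₂ (K u)) (proj₂ (K v))) (≼⇔∈slotℚ ×-⇔ ≼⇔∈slotℚ))
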